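{- Let $n$ be an odd positive integer and let $G_{n\times n}$ be the $n\times n$ square grid graph, i.e. the Cartesian product $P_n\square P_n$ of two paths on $n$ vertices (vertices $(i,j)$, $1\leqslant i,j\leqslant n$, with $(i,j)$ adjacent to $(i',j')$ iff $|i-i'|+|j-j'|=1$). Then (i) $\phi_{\min}(G_{n\times n})=(n-1)^2$ and (ii) $\phi_{\max}(G_{n\times n})=3(n-1)^2$.
   Context: All graphs are finite, simple and undirected. A numbering of a graph $G$ with $N$ vertices is a bijection $\pi:V(G)\to\{1,\dots,N\}$. A 2-path $\langle x,u,y\rangle$ of $G$ consists of a middle vertex $u$ and an unordered pair $\{x,y\}$ of two distinct neighbours of $u$. Given a numbering $\pi$, the 2-path $\langle x,u,y\rangle$ is valid if $\pi(u)<\min(\pi(x),\pi(y))$. The validity $\phi_\pi(G)$ is the number of valid 2-paths of $G$ under $\pi$; $\phi_{\min}(G)$ and $\phi_{\max}(G)$ are the minimum and maximum of $\phi_\pi(G)$ over all numberings $\pi$ of $G$. -}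

module Defs where

open import Data.Nat using (ℕ; zero; suc; _+_; _*_; _∸_; _≤_; _<ᵇ_; ∣_-_∣; _≡ᵇ_)
open import Data.Bool using (Bool; true; false; _∧_; if_then_else_)
open import Data.Fin using (Fin; toℕ; remQuot)
open import Data.Fin.Permutation using (Permutation′; _⟨$⟩ʳ_)
open import Data.List using (List; []; _∷_; map; allFin)
open import Data.Nat.ListAction using (sum)
open import Data.Nat.Properties using (∣n-n∣≡0; ∣-∣-comm)
open import Data.Product using (_×_; _,_; proj₁; proj₂; ∃)
open import Relation.Binary.PropositionalEquality using (_≡_; refl; cong₂)

record Graph (N : ℕ) : Set where
  field
    adj     : Fin N → Fin N → Bool
    adj-sym : ∀ x y → adj x y ≡ adj y x
    adj-irr : ∀ x → adj x x ≡ false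
open Graph public

-- A numbering of G is a bijection V(G) → {1,…,N}; we use Fin N = {0,…,N-1}
-- (a shift by one, irrelevant for comparisons).
Numbering : ℕ → Set
Numbering N = Permutation′ N

private
  lt : ∀ {N} → Fin N → Fin N → Bool
  lt a b = toℕ a <ᵇ toℕ b

-- Is the 2-path <x,u,y> (x,y distinct neighbours of u) valid under π?
-- Each unordered pair {x,y} is counted once by requiring x < y as indices.
valid2path : ∀ {N} → Graph N → Numbering N → Fin N → Fin N → Fin N → Bool
valid2path G π x u y =
  lt x y ∧ adj G u x ∧ adj G u y
    ∧ lt (π ⟨$⟩ʳ u) (π ⟨$⟩ʳ x) ∧ lt (π ⟨$⟩ʳ u) (π ⟨$⟩ʳ y)

count : ∀ {A : Set} → (A → Bool) → List A → ℕ
count p [] = 0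
count p (a ∷ as) = (if p a then 1 else 0) + count p as

validity : ∀ {N} → Graph N → Numbering N → ℕ
validity {N} G π =
  sum (map (λ u → sum (map (λ x → count (λ y → valid2path G π x u y) (allFin N))
                           (allFin N)))
           (allFin N))

IsPhiMin : ∀ {N} → Graph N → ℕ → Set
IsPhiMin {N} G k = (∀ (π : Numbering N) → k ≤ validity G π)
                 × ∃ (λ (π : Numbering N) → validity G π ≡ k)

IsPhiMax : ∀ {N} → Graph N → ℕ → Set
IsPhiMax {N} G k = (∀ (π : Numbering N) → validity G π ≤ k)
                 × ∃ (λ (π : Numbering N) → validity G π ≡ k)

gridAdjPair : ∀ {n} → Fin n × Fin n → Fin n × Fin n → Bool
gridAdjPair (i , j) (i' , j') = (∣ toℕ i - toℕ i' ∣ + ∣ toℕ j - toℕ j' ∣) ≡ᵇ 1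

gridAdj : ∀ n → Fin (n * n) → Fin (n * n) → Bool
gridAdj n v w = gridAdjPair (remQuot {n} n v) (remQuot {n} n w)

gridAdjPair-sym : ∀ {n} (p q : Fin n × Fin n) → gridAdjPair p q ≡ gridAdjPair q p
gridAdjPair-sym (i , j) (i' , j') =
  cong₂ (λ a b → (a + b) ≡ᵇ 1) (∣-∣-comm (toℕ i) (toℕ i')) (∣-∣-comm (toℕ j) (toℕ j'))

gridAdjPair-irr : ∀ {n} (p : Fin n × Fin n) → gridAdjPair p p ≡ false
gridAdjPair-irr (i , j) rewrite ∣n-n∣≡0 (toℕ i) | ∣n-n∣≡0 (toℕ j) = refl

Grid : ∀ n → Graph (n * n)
Grid n = record
  { adj     = gridAdj n
  ; adj-sym = λ v w → gridAdjPair-sym (remQuot {n} n v) (remQuot {n} n w)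
  ; adj-irr = λ v → gridAdjPair-irr (remQuot {n} n v)
  }

module Submission where

-- Let d⁺(u) be the number of neighbours of u numbered above u. The valid 2-paths centred
-- at u are the pairs of such neighbours, so φ_π = Σ_u C(d⁺(u), 2), while Σ_u d⁺(u) = |E|.
-- Lower bound: C(d, 2) ≥ d − 1, with slack 1 at the top vertex, so φ_π ≥ |E| − N + 1 = (n − 1)²;
-- the row-major numbering attains it, since there d⁺(u) counts at most the right and the
-- lower neighbour. Upper bound: give an edge weight 3 if it lies on a boundary row or column
-- and 6 otherwise. At every vertex 4 C(d⁺, 2) is at most the weight of the edges leaving it
-- upwards, and the total weight is 12 (n − 1)², so φ_π ≤ 3 (n − 1)². For odd n, numbering
-- first the vertices (i, j) with i + j odd makes each of them see all its neighbours above
-- it; none of them is a corner, and that is exactly when the weight inequality is tight.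

open import Defs
open import Data.Bool using (Bool; true; false; T; _∧_; _∨_; _xor_; not; if_then_else_)
open import Data.Bool.Properties using (not-involutive; not-distribˡ-xor; xor-same; xor-identityʳ)
open import Data.Empty using (⊥-elim)
open import Data.Fin using (Fin; zero; suc; toℕ; fromℕ; fromℕ<; combine; remQuot; _↑ˡ_; _↑ʳ_)
open import Data.Fin.Properties using (toℕ-fromℕ; toℕ-fromℕ<; toℕ-injective; toℕ<n; remQuot-combine; combine-remQuot; toℕ-combine)
import Data.Fin.Permutation
open import Data.Fin.Permutation using (permutation; _⟨$⟩ʳ_; _⟨$⟩ˡ_; inverseˡ; inverseʳ)
open import Data.List using ([]; _∷_; map; tabulate; allFin)
open import Data.List.Properties using (map-tabulate)
open import Data.Nat using (ℕ; zero; suc; _+_; _*_; _∸_; _^_; _⊓_; _≤_; _<_; ⌊_/2⌋; _<ᵇ_; _≡ᵇ_; ∣_-_∣; z≤n; s≤s)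
open import Data.Nat.Combinatorics using (_C_; nC1≡n; nCk+nC[k+1]≡[n+1]C[k+1])
import Data.Nat.ListAction as List
open import Data.Nat.Properties
open import Algebra.Properties.Semiring.Sum +-*-semiring
  using (sum; sum-syntax; sum-cong-≗; ∑-distrib-+; ∑-comm; *-distribˡ-sum; *-distribʳ-sum)
open import Data.Unit using (tt)
open import Data.Product using (_×_; _,_; proj₁; proj₂; ∃)
open import Function using (_∘_)
open import Data.Nat.Tactic.RingSolver using (solve-∀)
open import Relation.Binary.PropositionalEquality

⟦_⟧ : Bool → ℕ
⟦ b ⟧ = if b then 1 else 0

⟦∧⟧* : ∀ a b c → ⟦ a ∧ b ⟧ * c ≡ ⟦ a ⟧ * (⟦ b ⟧ * c)
⟦∧⟧* false b c = refl
⟦∧⟧* true  b c = sym (+-identityʳ _)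

⟦⟧*⟦⟧≤⟦⟧ : ∀ a b → ⟦ a ⟧ * ⟦ b ⟧ ≤ ⟦ a ⟧
⟦⟧*⟦⟧≤⟦⟧ false b     = z≤n
⟦⟧*⟦⟧≤⟦⟧ true  false = z≤n
⟦⟧*⟦⟧≤⟦⟧ true  true  = ≤-refl

⟦⟧≤1 : ∀ b → ⟦ b ⟧ ≤ 1
⟦⟧≤1 false = z≤n
⟦⟧≤1 true  = ≤-refl

⟦<ᵇ⟧+⟦>ᵇ⟧≡1 : ∀ {a b} → a ≢ b → ⟦ a <ᵇ b ⟧ + ⟦ b <ᵇ a ⟧ ≡ 1
⟦<ᵇ⟧+⟦>ᵇ⟧≡1 {zero}  {zero}  a≢b = ⊥-elim (a≢b refl)
⟦<ᵇ⟧+⟦>ᵇ⟧≡1 {zero}  {suc b} a≢b = refl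
⟦<ᵇ⟧+⟦>ᵇ⟧≡1 {suc a} {zero}  a≢b = refl
⟦<ᵇ⟧+⟦>ᵇ⟧≡1 {suc a} {suc b} a≢b = ⟦<ᵇ⟧+⟦>ᵇ⟧≡1 (a≢b ∘ cong suc)

≤⇒≮ᵇ : ∀ {m n} → m ≤ n → (n <ᵇ m) ≡ false
≤⇒≮ᵇ {zero}  {zero}  z≤n     = refl
≤⇒≮ᵇ {zero}  {suc n} z≤n     = refl
≤⇒≮ᵇ {suc m} {suc n} (s≤s p) = ≤⇒≮ᵇ p

<⇒<ᵇ≡true : ∀ {m n} → m < n → (m <ᵇ n) ≡ true
<⇒<ᵇ≡true {zero}  (s≤s _)   = refl
<⇒<ᵇ≡true {suc m} (s≤s m<n) = <⇒<ᵇ≡true m<n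

m+m<n+n⇒m<n : ∀ {m n} → m + m < n + n → m < n
m+m<n+n⇒m<n p = ≰⇒> (λ n≤m → <⇒≱ p (+-mono-≤ n≤m n≤m))

m+m≤n+n⇒m≤n : ∀ {m n} → m + m ≤ n + n → m ≤ n
m+m≤n+n⇒m≤n p = ≮⇒≥ (λ n<m → <⇒≱ (+-mono-< n<m n<m) p)

∑-const : ∀ n c → ∑[ i < n ] c ≡ n * c
∑-const zero    c = refl
∑-const (suc n) c = cong (c +_) (∑-const n c)

∑-zero : ∀ n → ∑[ i < n ] 0 ≡ 0
∑-zero n = trans (∑-const n 0) (*-zeroʳ n)

∑-mono-≤ : ∀ {n} {f g : Fin n → ℕ} → (∀ i → f i ≤ g i) → sum f ≤ sum g
∑-mono-≤ {zero}  f≤g = z≤n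
∑-mono-≤ {suc n} f≤g = +-mono-≤ (f≤g zero) (∑-mono-≤ (f≤g ∘ suc))

∑-mono-< : ∀ {n} {f g : Fin n → ℕ} (k : Fin n) → (∀ i → f i ≤ g i) → f k < g k → sum f < sum g
∑-mono-< {suc n} zero    f≤g fk<gk = +-mono-<-≤ fk<gk (∑-mono-≤ (f≤g ∘ suc))
∑-mono-< {suc n} (suc k) f≤g fk<gk = +-mono-≤-< (f≤g zero) (∑-mono-< k (f≤g ∘ suc) fk<gk)

∑-splitAt : ∀ m n (f : Fin (m + n) → ℕ) → sum f ≡ ∑[ i < m ] f (i ↑ˡ n) + ∑[ j < n ] f (m ↑ʳ j)
∑-splitAt zero    n f = refl
∑-splitAt (suc m) n f = trans (cong (f zero +_) (∑-splitAt m n (f ∘ suc))) (sym (+-assoc (f zero) _ _))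

∑-combine : ∀ m n (f : Fin (m * n) → ℕ) → sum f ≡ ∑[ i < m ] ∑[ j < n ] f (combine i j)
∑-combine zero    n f = refl
∑-combine (suc m) n f =
  trans (∑-splitAt n (m * n) f) (cong (∑[ j < n ] f (j ↑ˡ (m * n)) +_) (∑-combine m n (f ∘ (n ↑ʳ_))))

∑-⟦⟧*-cong : ∀ {n} (b : Fin n → Bool) {f g : Fin n → ℕ} → (∀ k → b k ≡ true → f k ≡ g k) →
  ∑[ k < n ] (⟦ b k ⟧ * f k) ≡ ∑[ k < n ] (⟦ b k ⟧ * g k)
∑-⟦⟧*-cong b {f} {g} f≡g = sum-cong-≗ pointwise
  where
  pointwise : ∀ k → ⟦ b k ⟧ * f k ≡ ⟦ b k ⟧ * g k
  pointwise k with b k in e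
  ... | false = refl
  ... | true  = cong (_+ 0) (f≡g k e)

∑-symmetric-product : ∀ n (a b : Fin n → ℕ) →
  ∑[ i < n ] ∑[ j < n ] (a j * b i + a i * b j) ≡ 2 * ((∑[ k < n ] a k) * (∑[ k < n ] b k))
∑-symmetric-product n a b = begin
  ∑[ i < n ] ∑[ j < n ] (a j * b i + a i * b j)
    ≡⟨ sum-cong-≗ (λ i → ∑-distrib-+ (λ j → a j * b i) (λ j → a i * b j)) ⟩
  ∑[ i < n ] (∑[ j < n ] (a j * b i) + ∑[ j < n ] (a i * b j))
    ≡⟨ sum-cong-≗ (λ i → cong₂ _+_ (sym (*-distribʳ-sum (b i) a)) (sym (*-distribˡ-sum (a i) b))) ⟩
  ∑[ i < n ] (A * b i + a i * B)
    ≡⟨ ∑-distrib-+ (λ i → A * b i) (λ i → a i * B) ⟩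
  ∑[ i < n ] (A * b i) + ∑[ i < n ] (a i * B)
    ≡⟨ cong₂ _+_ (sym (*-distribˡ-sum A b)) (sym (*-distribʳ-sum B a)) ⟩
  A * B + A * B
    ≡⟨ cong (A * B +_) (sym (+-identityʳ (A * B))) ⟩
  2 * (A * B) ∎
  where
  open ≡-Reasoning
  A B : ℕ
  A = ∑[ k < n ] a k
  B = ∑[ k < n ] b k

sum-tabulate : ∀ {n} (f : Fin n → ℕ) → List.sum (tabulate f) ≡ sum f
sum-tabulate {zero}  f = refl
sum-tabulate {suc n} f = cong (f zero +_) (sum-tabulate (f ∘ suc))

sum-map-allFin : ∀ n (f : Fin n → ℕ) → List.sum (map f (allFin n)) ≡ sum f
sum-map-allFin n f = trans (cong List.sum (map-tabulate (λ i → i) f)) (sum-tabulate f)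

count-map : ∀ {A : Set} (p : A → Bool) xs → count p xs ≡ List.sum (map (⟦_⟧ ∘ p) xs)
count-map p []       = refl
count-map p (x ∷ xs) = cong (⟦ p x ⟧ +_) (count-map p xs)

count-allFin : ∀ n (p : Fin n → Bool) → count p (allFin n) ≡ ∑[ i < n ] ⟦ p i ⟧
count-allFin n p = trans (count-map p (allFin n)) (sum-map-allFin n (⟦_⟧ ∘ p))

[1+n]C2 : ∀ n → suc n C 2 ≡ n + n C 2
[1+n]C2 n = trans (sym (nCk+nC[k+1]≡[n+1]C[k+1] n 1)) (cong (_+ n C 2) (nC1≡n n))

n≤nC2+1 : ∀ n → n ≤ n C 2 + 1
n≤nC2+1 zero    = z≤n
n≤nC2+1 (suc n) rewrite [1+n]C2 n = subst (suc n ≤_) (+-comm 1 (n + n C 2)) (s≤s (m≤m+n n (n C 2)))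

∑-pairs : ∀ n (P : Fin n → Bool) →
  ∑[ x < n ] ∑[ y < n ] ⟦ (toℕ x <ᵇ toℕ y) ∧ (P x ∧ P y) ⟧ ≡ (∑[ x < n ] ⟦ P x ⟧) C 2
∑-pairs zero    P = refl
∑-pairs (suc n) P with P zero
... | false = trans (cong (_+ rest) (∑-zero n)) (∑-pairs n (P ∘ suc))
  where
  rest : ℕ
  rest = ∑[ x < n ] ∑[ y < n ] ⟦ (toℕ x <ᵇ toℕ y) ∧ (P (suc x) ∧ P (suc y)) ⟧
... | true  = trans (cong (#P +_) (∑-pairs n (P ∘ suc))) (sym ([1+n]C2 #P))
  where
  #P : ℕ
  #P = ∑[ x < n ] ⟦ P (suc x) ⟧

[r+c]C2≤r*c : ∀ {r c} → r ≤ 1 → c ≤ 1 → (r + c) C 2 ≤ r * c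
[r+c]C2≤r*c z≤n       z≤n       = z≤n
[r+c]C2≤r*c z≤n       (s≤s z≤n) = z≤n
[r+c]C2≤r*c (s≤s z≤n) z≤n       = z≤n
[r+c]C2≤r*c (s≤s z≤n) (s≤s z≤n) = ≤-refl

-- Validity and up-degrees
module _ {N : ℕ} (G : Graph N) (π : Numbering N) where

  ascends : Fin N → Fin N → Bool
  ascends u x = adj G u x ∧ (toℕ (π ⟨$⟩ʳ u) <ᵇ toℕ (π ⟨$⟩ʳ x))

  upDegree : Fin N → ℕ
  upDegree u = ∑[ x < N ] ⟦ ascends u x ⟧

  -- A valid 2-path is a pair {x, y} of neighbours of u lying above u.
  validity≡∑upDegreeC2 : validity G π ≡ ∑[ u < N ] (upDegree u C 2)
  validity≡∑upDegreeC2 = begin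
    validity G π
      ≡⟨ sum-map-allFin N (λ u → List.sum (map (paths u) (allFin N))) ⟩
    ∑[ u < N ] List.sum (map (paths u) (allFin N))
      ≡⟨ sum-cong-≗ (λ u → trans (sum-map-allFin N (paths u))
                                 (sum-cong-≗ (λ x → count-allFin N (λ y → valid2path G π x u y)))) ⟩
    ∑[ u < N ] ∑[ x < N ] ∑[ y < N ] ⟦ valid2path G π x u y ⟧
      ≡⟨ sum-cong-≗ (λ u → trans (sum-cong-≗ (λ x → sum-cong-≗ (λ y → cong ⟦_⟧ (regroup u x y))))
                                 (∑-pairs N (ascends u))) ⟩
    ∑[ u < N ] (upDegree u C 2) ∎
    where
    open ≡-Reasoning
    paths : Fin N → Fin N → ℕ
    paths u x = count (λ y → valid2path G π x u y) (allFin N)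
    regroup : ∀ u x y → valid2path G π x u y ≡ ((toℕ x <ᵇ toℕ y) ∧ (ascends u x ∧ ascends u y))
    regroup u x y with toℕ x <ᵇ toℕ y | adj G u x | adj G u y | toℕ (π ⟨$⟩ʳ u) <ᵇ toℕ (π ⟨$⟩ʳ x)
    ... | false | _     | _     | _     = refl
    ... | true  | false | _     | _     = refl
    ... | true  | true  | false | false = refl
    ... | true  | true  | false | true  = refl
    ... | true  | true  | true  | _     = refl

  ascends-one-way : ∀ u x → ⟦ ascends u x ⟧ + ⟦ ascends x u ⟧ ≡ ⟦ adj G u x ⟧
  ascends-one-way u x rewrite adj-sym G x u with adj G u x in e
  ... | false = refl
  ... | true  = ⟦<ᵇ⟧+⟦>ᵇ⟧≡1 λ eq → loopless (subst (λ z → adj G z x ≡ true) (π-injective eq) e)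
    where
    π-injective : ∀ {u x} → toℕ (π ⟨$⟩ʳ u) ≡ toℕ (π ⟨$⟩ʳ x) → u ≡ x
    π-injective eq = trans (sym (inverseˡ π)) (trans (cong (π ⟨$⟩ˡ_) (toℕ-injective eq)) (inverseˡ π))
    loopless : adj G x x ≢ true
    loopless e' with trans (sym e') (adj-irr G x)
    ... | ()

  -- Every edge ascends in exactly one direction.
  ∑-ascends : (w : Fin N → Fin N → ℕ) → (∀ u x → w u x ≡ w x u) →
    2 * ∑[ u < N ] ∑[ x < N ] (⟦ ascends u x ⟧ * w u x) ≡ ∑[ u < N ] ∑[ x < N ] (⟦ adj G u x ⟧ * w u x)
  ∑-ascends w w-sym = begin
    2 * S
      ≡⟨ cong (S +_) (+-identityʳ S) ⟩
    S + S
      ≡⟨ cong (S +_) (∑-comm (λ u x → ⟦ ascends u x ⟧ * w u x)) ⟩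
    S + ∑[ u < N ] ∑[ x < N ] (⟦ ascends x u ⟧ * w x u)
      ≡⟨ sym (∑-distrib-+ out in′) ⟩
    ∑[ u < N ] (out u + in′ u)
      ≡⟨ sum-cong-≗ (λ u → trans (sym (∑-distrib-+ (λ x → ⟦ ascends u x ⟧ * w u x) (λ x → ⟦ ascends x u ⟧ * w x u)))
                                 (sum-cong-≗ (pair u))) ⟩
    ∑[ u < N ] ∑[ x < N ] (⟦ adj G u x ⟧ * w u x) ∎
    where
    open ≡-Reasoning
    S : ℕ
    S = ∑[ u < N ] ∑[ x < N ] (⟦ ascends u x ⟧ * w u x)
    out in′ : Fin N → ℕ
    out u = ∑[ x < N ] (⟦ ascends u x ⟧ * w u x)
    in′ u = ∑[ x < N ] (⟦ ascends x u ⟧ * w x u)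
    pair : ∀ u x → ⟦ ascends u x ⟧ * w u x + ⟦ ascends x u ⟧ * w x u ≡ ⟦ adj G u x ⟧ * w u x
    pair u x rewrite w-sym x u = trans (sym (*-distribʳ-+ (w u x) ⟦ ascends u x ⟧ _))
                                       (cong (_* w u x) (ascends-one-way u x))

  ∑-upDegree : 2 * ∑[ u < N ] upDegree u ≡ ∑[ u < N ] ∑[ x < N ] (⟦ adj G u x ⟧ * 1)
  ∑-upDegree = begin
    2 * ∑[ u < N ] upDegree u
      ≡⟨ cong (2 *_) (sum-cong-≗ (λ u → sum-cong-≗ (λ x → sym (*-identityʳ ⟦ ascends u x ⟧)))) ⟩
    2 * ∑[ u < N ] ∑[ x < N ] (⟦ ascends u x ⟧ * 1)
      ≡⟨ ∑-ascends (λ _ _ → 1) (λ _ _ → refl) ⟩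
    ∑[ u < N ] ∑[ x < N ] (⟦ adj G u x ⟧ * 1) ∎
    where open ≡-Reasoning

*-distribˡ-validity : ∀ {N} (G : Graph N) π c → c * validity G π ≡ ∑[ u < N ] (c * (upDegree G π u C 2))
*-distribˡ-validity G π c = trans (cong (c *_) (validity≡∑upDegreeC2 G π)) (*-distribˡ-sum c (λ u → upDegree G π u C 2))

upDegree-top : ∀ {M} (G : Graph (suc M)) (π : Numbering (suc M)) → upDegree G π (π ⟨$⟩ˡ fromℕ M) ≡ 0
upDegree-top {M} G π = trans (sum-cong-≗ nothing-above) (∑-zero (suc M))
  where
  top : Fin (suc M)
  top = π ⟨$⟩ˡ fromℕ M
  nothing-above : ∀ x → ⟦ ascends G π top x ⟧ ≡ 0
  nothing-above x rewrite inverseʳ π {fromℕ M} | toℕ-fromℕ M | ≤⇒≮ᵇ (≤-pred (toℕ<n (π ⟨$⟩ʳ x)))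
    with adj G top x
  ... | false = refl
  ... | true  = refl

-- Since d ≤ d C 2 + 1, with strict inequality at the top vertex.
∑upDegree<validity+N : ∀ {M} (G : Graph (suc M)) (π : Numbering (suc M)) →
  suc (∑[ u < suc M ] upDegree G π u) ≤ validity G π + suc M
∑upDegree<validity+N {M} G π = begin-strict
  ∑[ u < N ] upDegree G π u                   <⟨ ∑-mono-< (π ⟨$⟩ˡ fromℕ M) (λ u → n≤nC2+1 (upDegree G π u)) top< ⟩
  ∑[ u < N ] (upDegree G π u C 2 + 1)         ≡⟨ ∑-distrib-+ (λ u → upDegree G π u C 2) (λ _ → 1) ⟩
  ∑[ u < N ] (upDegree G π u C 2) + ∑[ u < N ] 1
    ≡⟨ cong₂ _+_ (sym (validity≡∑upDegreeC2 G π)) (trans (∑-const N 1) (*-identityʳ N)) ⟩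
  validity G π + N ∎
  where
  open ≤-Reasoning
  N : ℕ
  N = suc M
  top< : upDegree G π (π ⟨$⟩ˡ fromℕ M) < upDegree G π (π ⟨$⟩ˡ fromℕ M) C 2 + 1
  top< rewrite upDegree-top G π = s≤s z≤n

pathAdj : ∀ {n} → Fin n → Fin n → Bool
pathAdj a b = ∣ toℕ a - toℕ b ∣ ≡ᵇ 1

pathDegree : ∀ {n} → Fin n → ℕ
pathDegree {n} k = ∑[ k′ < n ] ⟦ pathAdj k k′ ⟧

∑-⟦toℕ≡ᵇ⟧ : ∀ n c → ∑[ k < n ] ⟦ toℕ k ≡ᵇ c ⟧ ≡ ⟦ c <ᵇ n ⟧
∑-⟦toℕ≡ᵇ⟧ zero    c       = refl
∑-⟦toℕ≡ᵇ⟧ (suc n) zero    = cong suc (∑-zero n)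
∑-⟦toℕ≡ᵇ⟧ (suc n) (suc c) = ∑-⟦toℕ≡ᵇ⟧ n c

∑-⟦toℕ<ᵇ⟧ : ∀ n c → ∑[ k < n ] ⟦ toℕ k <ᵇ c ⟧ ≡ n ⊓ c
∑-⟦toℕ<ᵇ⟧ zero    c       = refl
∑-⟦toℕ<ᵇ⟧ (suc n) zero    = ∑-zero n
∑-⟦toℕ<ᵇ⟧ (suc n) (suc c) = cong suc (∑-⟦toℕ<ᵇ⟧ n c)

hasLeft hasRight interior : ∀ {n} → Fin n → Bool
hasLeft k = 0 <ᵇ toℕ k
hasRight {n} k = suc (toℕ k) <ᵇ n
interior k = hasLeft k ∧ hasRight k

∑-hasLeft : ∀ n → ∑[ k < n ] ⟦ hasLeft k ⟧ ≡ n ∸ 1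
∑-hasLeft zero    = refl
∑-hasLeft (suc n) = trans (∑-const n 1) (*-identityʳ n)

∑-hasRight : ∀ n → ∑[ k < n ] ⟦ hasRight k ⟧ ≡ n ∸ 1
∑-hasRight zero    = refl
∑-hasRight (suc n) = trans (∑-⟦toℕ<ᵇ⟧ (suc n) n) (m≥n⇒m⊓n≡n (n≤1+n n))

∑-interior : ∀ n → ∑[ k < n ] ⟦ interior k ⟧ ≡ n ∸ 2
∑-interior zero    = refl
∑-interior (suc n) = ∑-hasRight n

pathDegree≡ : ∀ {n} (k : Fin n) → pathDegree k ≡ ⟦ hasLeft k ⟧ + ⟦ hasRight k ⟧
pathDegree≡ {n} k = go n (toℕ k) (toℕ<n k)
  where
  go : ∀ n a → a < n → ∑[ k < n ] ⟦ ∣ a - toℕ k ∣ ≡ᵇ 1 ⟧ ≡ ⟦ 0 <ᵇ a ⟧ + ⟦ suc a <ᵇ n ⟧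
  go (suc n) zero    _       = ∑-⟦toℕ≡ᵇ⟧ (suc n) 1
  go (suc n) (suc a) (s≤s a<n) = begin
    ⟦ a ≡ᵇ 0 ⟧ + ∑[ k < n ] ⟦ ∣ a - toℕ k ∣ ≡ᵇ 1 ⟧  ≡⟨ cong (⟦ a ≡ᵇ 0 ⟧ +_) (go n a a<n) ⟩
    ⟦ a ≡ᵇ 0 ⟧ + (⟦ 0 <ᵇ a ⟧ + ⟦ suc a <ᵇ n ⟧)      ≡⟨ sym (+-assoc ⟦ a ≡ᵇ 0 ⟧ _ _) ⟩
    ⟦ a ≡ᵇ 0 ⟧ + ⟦ 0 <ᵇ a ⟧ + ⟦ suc a <ᵇ n ⟧        ≡⟨ cong (_+ ⟦ suc a <ᵇ n ⟧) (zero-or-positive a) ⟩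
    1 + ⟦ suc a <ᵇ n ⟧ ∎
    where
    open ≡-Reasoning
    zero-or-positive : ∀ a → ⟦ a ≡ᵇ 0 ⟧ + ⟦ 0 <ᵇ a ⟧ ≡ 1
    zero-or-positive zero    = refl
    zero-or-positive (suc a) = refl

∑-pathDegree : ∀ n → ∑[ k < n ] pathDegree k ≡ (n ∸ 1) + (n ∸ 1)
∑-pathDegree n = trans (sum-cong-≗ {n} pathDegree≡)
  (trans (∑-distrib-+ {n} (λ k → ⟦ hasLeft k ⟧) (λ k → ⟦ hasRight k ⟧)) (cong₂ _+_ (∑-hasLeft n) (∑-hasRight n)))

pathDegree≤ : ∀ {n} (k : Fin n) → pathDegree k ≤ suc ⟦ interior k ⟧
pathDegree≤ k rewrite pathDegree≡ k with hasLeft k | hasRight k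
... | false | false = z≤n
... | false | true  = ≤-refl
... | true  | false = ≤-refl
... | true  | true  = ≤-refl

pathDegree≡1+interior : ∀ {n} (k : Fin n) → 2 ≤ n → pathDegree k ≡ suc ⟦ interior k ⟧
pathDegree≡1+interior {n} k 2≤n rewrite pathDegree≡ k = go n (toℕ k) (toℕ<n k) 2≤n
  where
  go : ∀ n a → a < n → 2 ≤ n → ⟦ 0 <ᵇ a ⟧ + ⟦ suc a <ᵇ n ⟧ ≡ suc ⟦ (0 <ᵇ a) ∧ (suc a <ᵇ n) ⟧
  go (suc (suc n)) zero    _ _ = refl
  go (suc (suc n)) (suc a) _ _ = refl
  go (suc zero)    _       _ (s≤s ())

∑-diagonal : ∀ {n} (j : Fin n) (H : Fin n → ℕ) → ∑[ k < n ] (⟦ ∣ toℕ j - toℕ k ∣ ≡ᵇ 0 ⟧ * H k) ≡ H j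
∑-diagonal {suc n} zero    H rewrite ∑-zero n = trans (+-identityʳ _) (+-identityʳ (H zero))
∑-diagonal {suc n} (suc j) H = ∑-diagonal j (H ∘ suc)

⟦a+b≡ᵇ1⟧ : ∀ a b → ⟦ (a + b) ≡ᵇ 1 ⟧ ≡ ⟦ a ≡ᵇ 0 ⟧ * ⟦ b ≡ᵇ 1 ⟧ + ⟦ a ≡ᵇ 1 ⟧ * ⟦ b ≡ᵇ 0 ⟧
⟦a+b≡ᵇ1⟧ zero          b = sym (trans (+-identityʳ _) (*-identityˡ _))
⟦a+b≡ᵇ1⟧ (suc zero)    b = sym (+-identityʳ _)
⟦a+b≡ᵇ1⟧ (suc (suc a)) b = refl

gridAdj-combine : ∀ n (i j i′ j′ : Fin n) →
  gridAdj n (combine i j) (combine i′ j′) ≡ ((∣ toℕ i - toℕ i′ ∣ + ∣ toℕ j - toℕ j′ ∣) ≡ᵇ 1)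
gridAdj-combine n i j i′ j′ = cong₂ gridAdjPair (remQuot-combine {n} {n} i j) (remQuot-combine {n} {n} i′ j′)

∑-gridNeighbours : ∀ n (i j : Fin n) (F : Fin (n * n) → ℕ) →
  ∑[ x < n * n ] (⟦ gridAdj n (combine i j) x ⟧ * F x)
    ≡ ∑[ j′ < n ] (⟦ pathAdj j j′ ⟧ * F (combine i j′)) + ∑[ i′ < n ] (⟦ pathAdj i i′ ⟧ * F (combine i′ j))
∑-gridNeighbours n i j F = begin
  ∑[ x < n * n ] (⟦ gridAdj n (combine i j) x ⟧ * F x)
    ≡⟨ ∑-combine n n (λ x → ⟦ gridAdj n (combine i j) x ⟧ * F x) ⟩
  ∑[ i′ < n ] ∑[ j′ < n ] (⟦ gridAdj n (combine i j) (combine i′ j′) ⟧ * F (combine i′ j′))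
    ≡⟨ sum-cong-≗ (λ i′ → sum-cong-≗ (split i′)) ⟩
  ∑[ i′ < n ] ∑[ j′ < n ] (δ i i′ * (⟦ pathAdj j j′ ⟧ * F (combine i′ j′)) + ⟦ pathAdj i i′ ⟧ * (δ j j′ * F (combine i′ j′)))
    ≡⟨ sum-cong-≗ (λ i′ → collapse-column i′) ⟩
  ∑[ i′ < n ] (δ i i′ * row i′ + ⟦ pathAdj i i′ ⟧ * F (combine i′ j))
    ≡⟨ ∑-distrib-+ (λ i′ → δ i i′ * row i′) (λ i′ → ⟦ pathAdj i i′ ⟧ * F (combine i′ j)) ⟩
  ∑[ i′ < n ] (δ i i′ * row i′) + ∑[ i′ < n ] (⟦ pathAdj i i′ ⟧ * F (combine i′ j))
    ≡⟨ cong (_+ ∑[ i′ < n ] (⟦ pathAdj i i′ ⟧ * F (combine i′ j))) (∑-diagonal i row) ⟩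
  row i + ∑[ i′ < n ] (⟦ pathAdj i i′ ⟧ * F (combine i′ j)) ∎
  where
  open ≡-Reasoning
  δ : Fin n → Fin n → ℕ
  δ a b = ⟦ ∣ toℕ a - toℕ b ∣ ≡ᵇ 0 ⟧
  row : Fin n → ℕ
  row i′ = ∑[ j′ < n ] (⟦ pathAdj j j′ ⟧ * F (combine i′ j′))
  split : ∀ i′ j′ → ⟦ gridAdj n (combine i j) (combine i′ j′) ⟧ * F (combine i′ j′)
    ≡ δ i i′ * (⟦ pathAdj j j′ ⟧ * F (combine i′ j′)) + ⟦ pathAdj i i′ ⟧ * (δ j j′ * F (combine i′ j′))
  split i′ j′ rewrite gridAdj-combine n i j i′ j′ | ⟦a+b≡ᵇ1⟧ ∣ toℕ i - toℕ i′ ∣ ∣ toℕ j - toℕ j′ ∣ =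
    trans (*-distribʳ-+ (F (combine i′ j′)) (δ i i′ * ⟦ pathAdj j j′ ⟧) _)
          (cong₂ _+_ (*-assoc (δ i i′) _ _) (*-assoc ⟦ pathAdj i i′ ⟧ _ _))
  collapse-column : ∀ i′ →
    ∑[ j′ < n ] (δ i i′ * (⟦ pathAdj j j′ ⟧ * F (combine i′ j′)) + ⟦ pathAdj i i′ ⟧ * (δ j j′ * F (combine i′ j′)))
      ≡ δ i i′ * row i′ + ⟦ pathAdj i i′ ⟧ * F (combine i′ j)
  collapse-column i′ =
    trans (∑-distrib-+ (λ j′ → δ i i′ * (⟦ pathAdj j j′ ⟧ * F (combine i′ j′)))
                       (λ j′ → ⟦ pathAdj i i′ ⟧ * (δ j j′ * F (combine i′ j′))))
          (cong₂ _+_ (sym (*-distribˡ-sum (δ i i′) (λ j′ → ⟦ pathAdj j j′ ⟧ * F (combine i′ j′))))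
                     (trans (sym (*-distribˡ-sum ⟦ pathAdj i i′ ⟧ (λ j′ → δ j j′ * F (combine i′ j′))))
                            (cong (⟦ pathAdj i i′ ⟧ *_) (∑-diagonal j (F ∘ combine i′)))))

∀-combine : ∀ n {P : Fin (n * n) → Set} → (∀ i j → P (combine i j)) → ∀ u → P u
∀-combine n {P} p u = subst P (combine-remQuot {n} n u) (p (proj₁ (remQuot {n} n u)) (proj₂ (remQuot {n} n u)))

record LineWeighted n (F : Fin (n * n) → Fin (n * n) → ℕ) (ω : Fin n → ℕ) : Set where
  field
    on-row    : ∀ (i : Fin n) {j j′ : Fin n} → pathAdj j j′ ≡ true → F (combine i j) (combine i j′) ≡ ω i
    on-column : ∀ (j : Fin n) {i i′ : Fin n} → pathAdj i i′ ≡ true → F (combine i j) (combine i′ j) ≡ ω j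

∑-gridEdges : ∀ n {F ω} → LineWeighted n F ω →
  ∑[ u < n * n ] ∑[ x < n * n ] (⟦ gridAdj n u x ⟧ * F u x) ≡ 2 * ((∑[ k < n ] pathDegree k) * (∑[ k < n ] ω k))
∑-gridEdges n {F} {ω} lw = begin
  ∑[ u < n * n ] ∑[ x < n * n ] (⟦ gridAdj n u x ⟧ * F u x)
    ≡⟨ ∑-combine n n (λ u → ∑[ x < n * n ] (⟦ gridAdj n u x ⟧ * F u x)) ⟩
  ∑[ i < n ] ∑[ j < n ] ∑[ x < n * n ] (⟦ gridAdj n (combine i j) x ⟧ * F (combine i j) x)
    ≡⟨ sum-cong-≗ (λ i → sum-cong-≗ (λ j →
         trans (∑-gridNeighbours n i j (F (combine i j))) (cong₂ _+_ (row i j) (column i j)))) ⟩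
  ∑[ i < n ] ∑[ j < n ] (pathDegree j * ω i + pathDegree i * ω j)
    ≡⟨ ∑-symmetric-product n pathDegree ω ⟩
  2 * ((∑[ k < n ] pathDegree k) * (∑[ k < n ] ω k)) ∎
  where
  open ≡-Reasoning
  open LineWeighted lw
  row : ∀ i j → ∑[ j′ < n ] (⟦ pathAdj j j′ ⟧ * F (combine i j) (combine i j′)) ≡ pathDegree j * ω i
  row i j = trans (∑-⟦⟧*-cong (pathAdj j) (λ j′ → on-row i {j} {j′})) (sym (*-distribʳ-sum (ω i) (⟦_⟧ ∘ pathAdj j)))
  column : ∀ i j → ∑[ i′ < n ] (⟦ pathAdj i i′ ⟧ * F (combine i j) (combine i′ j)) ≡ pathDegree i * ω j
  column i j = trans (∑-⟦⟧*-cong (pathAdj i) (λ i′ → on-column j {i} {i′})) (sym (*-distribʳ-sum (ω j) (⟦_⟧ ∘ pathAdj i)))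

lineWeight : ∀ {n} → (Fin n → ℕ) → Fin n × Fin n → Fin n × Fin n → ℕ
lineWeight ω (i , j) (i′ , j′) = ⟦ toℕ i ≡ᵇ toℕ i′ ⟧ * ω i + ⟦ toℕ j ≡ᵇ toℕ j′ ⟧ * ω j

gridWeight : ∀ n → (Fin n → ℕ) → Fin (n * n) → Fin (n * n) → ℕ
gridWeight n ω u x = lineWeight ω (remQuot {n} n u) (remQuot {n} n x)

⟦≡ᵇ⟧*-sym : ∀ {n} (ω : Fin n → ℕ) (a b : Fin n) → ⟦ toℕ a ≡ᵇ toℕ b ⟧ * ω a ≡ ⟦ toℕ b ≡ᵇ toℕ a ⟧ * ω b
⟦≡ᵇ⟧*-sym ω zero    zero    = refl
⟦≡ᵇ⟧*-sym ω zero    (suc b) = refl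
⟦≡ᵇ⟧*-sym ω (suc a) zero    = refl
⟦≡ᵇ⟧*-sym ω (suc a) (suc b) = ⟦≡ᵇ⟧*-sym (ω ∘ suc) a b

lineWeight-sym : ∀ {n} (ω : Fin n → ℕ) p q → lineWeight ω p q ≡ lineWeight ω q p
lineWeight-sym ω (i , j) (i′ , j′) = cong₂ _+_ (⟦≡ᵇ⟧*-sym ω i i′) (⟦≡ᵇ⟧*-sym ω j j′)

gridWeight-sym : ∀ n ω (u x : Fin (n * n)) → gridWeight n ω u x ≡ gridWeight n ω x u
gridWeight-sym n ω u x = lineWeight-sym ω (remQuot {n} n u) (remQuot {n} n x)

gridWeight-lineWeighted : ∀ n ω → LineWeighted n (gridWeight n ω) ω
gridWeight-lineWeighted n ω = record { on-row = on-row ; on-column = on-column }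
  where
  weight-combine : ∀ i j i′ j′ → gridWeight n ω (combine i j) (combine i′ j′) ≡ lineWeight ω (i , j) (i′ , j′)
  weight-combine i j i′ j′ = cong₂ (lineWeight ω) (remQuot-combine {n} {n} i j) (remQuot-combine {n} {n} i′ j′)
  ≡ᵇ-refl : ∀ a → (a ≡ᵇ a) ≡ true
  ≡ᵇ-refl zero    = refl
  ≡ᵇ-refl (suc a) = ≡ᵇ-refl a
  pathAdj⇒≢ᵇ : ∀ a b → pathAdj a b ≡ true → (toℕ a ≡ᵇ toℕ b) ≡ false
  pathAdj⇒≢ᵇ a b = go (toℕ a) (toℕ b)
    where
    go : ∀ a b → (∣ a - b ∣ ≡ᵇ 1) ≡ true → (a ≡ᵇ b) ≡ false
    go zero    (suc b) _ = refl
    go (suc a) zero    _ = refl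
    go (suc a) (suc b) e = go a b e
  on-row : ∀ (i : Fin n) {j j′ : Fin n} → pathAdj j j′ ≡ true → gridWeight n ω (combine i j) (combine i j′) ≡ ω i
  on-row i {j} {j′} adj rewrite weight-combine i j i j′ | ≡ᵇ-refl (toℕ i) | pathAdj⇒≢ᵇ j j′ adj =
    trans (+-identityʳ _) (+-identityʳ (ω i))
  on-column : ∀ (j : Fin n) {i i′ : Fin n} → pathAdj i i′ ≡ true → gridWeight n ω (combine i j) (combine i′ j) ≡ ω j
  on-column j {i} {i′} adj rewrite weight-combine i j i′ j | ≡ᵇ-refl (toℕ j) | pathAdj⇒≢ᵇ i i′ adj =
    +-identityʳ (ω j)

constant-lineWeighted : ∀ n → LineWeighted n (λ _ _ → 1) (λ _ → 1)
constant-lineWeighted n = record { on-row = λ _ _ → refl ; on-column = λ _ _ → refl }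

module _ (n : ℕ) (π : Numbering (n * n)) (i j : Fin n) where

  above : Fin (n * n) → ℕ
  above x = ⟦ toℕ (π ⟨$⟩ʳ combine i j) <ᵇ toℕ (π ⟨$⟩ʳ x) ⟧

  rowUp colUp : ℕ
  rowUp = ∑[ j′ < n ] (⟦ pathAdj j j′ ⟧ * above (combine i j′))
  colUp = ∑[ i′ < n ] (⟦ pathAdj i i′ ⟧ * above (combine i′ j))

  ∑-ascends-combine : ∀ {F ω} → LineWeighted n F ω →
    ∑[ x < n * n ] (⟦ ascends (Grid n) π (combine i j) x ⟧ * F (combine i j) x) ≡ rowUp * ω i + colUp * ω j
  ∑-ascends-combine {F} {ω} lw = begin
    ∑[ x < n * n ] (⟦ ascends (Grid n) π u x ⟧ * F u x)
      ≡⟨ sum-cong-≗ (λ x → ⟦∧⟧* (gridAdj n u x) _ (F u x)) ⟩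
    ∑[ x < n * n ] (⟦ gridAdj n u x ⟧ * (above x * F u x))
      ≡⟨ ∑-gridNeighbours n i j (λ x → above x * F u x) ⟩
    ∑[ j′ < n ] (⟦ pathAdj j j′ ⟧ * (above (combine i j′) * F u (combine i j′)))
      + ∑[ i′ < n ] (⟦ pathAdj i i′ ⟧ * (above (combine i′ j) * F u (combine i′ j)))
      ≡⟨ cong₂ _+_ (∑-⟦⟧*-cong (pathAdj j) (λ j′ e → cong (above (combine i j′) *_) (on-row i {j} {j′} e)))
                   (∑-⟦⟧*-cong (pathAdj i) (λ i′ e → cong (above (combine i′ j) *_) (on-column j {i} {i′} e))) ⟩
    ∑[ j′ < n ] (⟦ pathAdj j j′ ⟧ * (above (combine i j′) * ω i))
      + ∑[ i′ < n ] (⟦ pathAdj i i′ ⟧ * (above (combine i′ j) * ω j))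
      ≡⟨ cong₂ _+_ (factor (λ j′ → ⟦ pathAdj j j′ ⟧) (λ j′ → above (combine i j′)) (ω i))
                   (factor (λ i′ → ⟦ pathAdj i i′ ⟧) (λ i′ → above (combine i′ j)) (ω j)) ⟩
    rowUp * ω i + colUp * ω j ∎
    where
    open ≡-Reasoning
    open LineWeighted lw
    u : Fin (n * n)
    u = combine i j
    factor : ∀ (a b : Fin n → ℕ) c → ∑[ k < n ] (a k * (b k * c)) ≡ (∑[ k < n ] (a k * b k)) * c
    factor a b c = trans (sum-cong-≗ (λ k → sym (*-assoc (a k) (b k) c))) (sym (*-distribʳ-sum c (λ k → a k * b k)))

  upDegree-combine : upDegree (Grid n) π (combine i j) ≡ rowUp + colUp
  upDegree-combine =
    trans (sum-cong-≗ (λ x → sym (*-identityʳ ⟦ ascends (Grid n) π (combine i j) x ⟧)))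
          (trans (∑-ascends-combine (constant-lineWeighted n)) (cong₂ _+_ (*-identityʳ rowUp) (*-identityʳ colUp)))

  rowUp≤pathDegree : rowUp ≤ pathDegree j
  rowUp≤pathDegree = ∑-mono-≤ (λ j′ → ⟦⟧*⟦⟧≤⟦⟧ (pathAdj j j′) _)

  colUp≤pathDegree : colUp ≤ pathDegree i
  colUp≤pathDegree = ∑-mono-≤ (λ i′ → ⟦⟧*⟦⟧≤⟦⟧ (pathAdj i i′) _)

-- The lower bound
validity-lower : ∀ n (π : Numbering (n * n)) → (n ∸ 1) ^ 2 ≤ validity (Grid n) π
validity-lower zero    π = z≤n
validity-lower (suc m) π = +-cancelʳ-≤ (suc m * suc m) _ _ (begin
  m ^ 2 + suc m * suc m                    ≡⟨ identity m ⟩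
  suc ((m + m) * (suc m * 1))              ≡⟨ cong suc (trans #edges (cong₂ _*_ (∑-pathDegree n) (∑-const n 1))) ⟨
  suc (∑[ u < n * n ] upDegree G π u)      ≤⟨ ∑upDegree<validity+N G π ⟩
  validity G π + suc m * suc m ∎)
  where
  open ≤-Reasoning
  n : ℕ
  n = suc m
  G : Graph (n * n)
  G = Grid n
  identity : ∀ m → m * (m * 1) + suc m * suc m ≡ suc ((m + m) * (suc m * 1))
  identity = solve-∀
  #edges : ∑[ u < n * n ] upDegree G π u ≡ (∑[ k < n ] pathDegree k) * (∑[ k < n ] 1)
  #edges = *-cancelˡ-≡ _ _ 2 (trans (∑-upDegree G π) (∑-gridEdges n (constant-lineWeighted n)))

⟦pathAdj⟧*⟦<ᵇ⟧≤⟦successor⟧ : ∀ (f : ℕ → ℕ) → (∀ {x y} → x ≤ y → f x ≤ f y) → ∀ a a′ →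
  ⟦ ∣ a - a′ ∣ ≡ᵇ 1 ⟧ * ⟦ f a <ᵇ f a′ ⟧ ≤ ⟦ a′ ≡ᵇ suc a ⟧
⟦pathAdj⟧*⟦<ᵇ⟧≤⟦successor⟧ f mono zero    zero     = z≤n
⟦pathAdj⟧*⟦<ᵇ⟧≤⟦successor⟧ f mono zero    (suc a′) = ⟦⟧*⟦⟧≤⟦⟧ (a′ ≡ᵇ 0) _
⟦pathAdj⟧*⟦<ᵇ⟧≤⟦successor⟧ f mono (suc a) zero
  rewrite ≤⇒≮ᵇ (mono (z≤n {suc a})) | *-zeroʳ ⟦ a ≡ᵇ 0 ⟧ = z≤n
⟦pathAdj⟧*⟦<ᵇ⟧≤⟦successor⟧ f mono (suc a) (suc a′) =
  ⟦pathAdj⟧*⟦<ᵇ⟧≤⟦successor⟧ (f ∘ suc) (mono ∘ s≤s) a a′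

module _ (n : ℕ) (i j : Fin n) where

  private
    ι : Numbering (n * n)
    ι = Data.Fin.Permutation.id

  rowUp-id : rowUp n ι i j ≤ ⟦ hasRight j ⟧
  rowUp-id = ≤-trans (∑-mono-≤ step) (≤-reflexive (∑-⟦toℕ≡ᵇ⟧ n (suc (toℕ j))))
    where
    step : ∀ j′ → ⟦ pathAdj j j′ ⟧ * above n ι i j (combine i j′) ≤ ⟦ toℕ j′ ≡ᵇ suc (toℕ j) ⟧
    step j′ rewrite toℕ-combine i j | toℕ-combine i j′ =
      ⟦pathAdj⟧*⟦<ᵇ⟧≤⟦successor⟧ (λ b → n * toℕ i + b) (+-monoʳ-≤ (n * toℕ i)) (toℕ j) (toℕ j′)

  colUp-id : colUp n ι i j ≤ ⟦ hasRight i ⟧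
  colUp-id = ≤-trans (∑-mono-≤ step) (≤-reflexive (∑-⟦toℕ≡ᵇ⟧ n (suc (toℕ i))))
    where
    step : ∀ i′ → ⟦ pathAdj i i′ ⟧ * above n ι i j (combine i′ j) ≤ ⟦ toℕ i′ ≡ᵇ suc (toℕ i) ⟧
    step i′ rewrite toℕ-combine i j | toℕ-combine i′ j =
      ⟦pathAdj⟧*⟦<ᵇ⟧≤⟦successor⟧ (λ a → n * a + toℕ j) (λ a≤b → +-monoˡ-≤ (toℕ j) (*-monoʳ-≤ n a≤b)) (toℕ i) (toℕ i′)

validity-id≤ : ∀ n → validity (Grid n) (Data.Fin.Permutation.id {n * n}) ≤ (n ∸ 1) ^ 2
validity-id≤ n = begin
  validity (Grid n) ι                                    ≡⟨ validity≡∑upDegreeC2 (Grid n) ι ⟩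
  ∑[ u < n * n ] (upDegree (Grid n) ι u C 2)             ≡⟨ ∑-combine n n (λ u → upDegree (Grid n) ι u C 2) ⟩
  ∑[ i < n ] ∑[ j < n ] (upDegree (Grid n) ι (combine i j) C 2) ≤⟨ ∑-mono-≤ (λ i → ∑-mono-≤ (vertex i)) ⟩
  ∑[ i < n ] ∑[ j < n ] (⟦ hasRight j ⟧ * ⟦ hasRight i ⟧)
    ≡⟨ sum-cong-≗ {n} (λ i → sym (*-distribʳ-sum {n} ⟦ hasRight i ⟧ (λ j → ⟦ hasRight j ⟧))) ⟩
  ∑[ i < n ] (R * ⟦ hasRight i ⟧)                        ≡⟨ sym (*-distribˡ-sum {n} R (λ i → ⟦ hasRight i ⟧)) ⟩
  R * R                                                  ≡⟨ cong₂ _*_ (∑-hasRight n) (∑-hasRight n) ⟩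
  (n ∸ 1) * (n ∸ 1)                                      ≡⟨ cong ((n ∸ 1) *_) (*-identityʳ (n ∸ 1)) ⟨
  (n ∸ 1) ^ 2 ∎
  where
  open ≤-Reasoning
  ι : Numbering (n * n)
  ι = Data.Fin.Permutation.id
  R : ℕ
  R = ∑[ k < n ] ⟦ hasRight k ⟧
  vertex : ∀ i j → upDegree (Grid n) ι (combine i j) C 2 ≤ ⟦ hasRight j ⟧ * ⟦ hasRight i ⟧
  vertex i j rewrite upDegree-combine n ι i j =
    ≤-trans ([r+c]C2≤r*c (≤-trans (rowUp-id n i j) (⟦⟧≤1 (hasRight j))) (≤-trans (colUp-id n i j) (⟦⟧≤1 (hasRight i))))
            (*-mono-≤ (rowUp-id n i j) (colUp-id n i j))

-- The upper bound
charge : ∀ {n} → Fin n → ℕ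
charge k = 3 + 3 * ⟦ interior k ⟧

∑-charge : ∀ n → ∑[ k < n ] charge k ≡ 3 * n + 3 * (n ∸ 2)
∑-charge n = trans (∑-distrib-+ {n} (λ _ → 3) (λ k → 3 * ⟦ interior k ⟧))
  (cong₂ _+_ (trans (∑-const n 3) (*-comm n 3))
             (trans (sym (*-distribˡ-sum {n} 3 (λ k → ⟦ interior k ⟧))) (cong (3 *_) (∑-interior n))))

-- r and c count the ascending row and column edges at (i, j), and a, b tell whether i, j are interior.
charge-bound : ∀ a b {r c} → r ≤ suc ⟦ b ⟧ → c ≤ suc ⟦ a ⟧ →
  4 * ((r + c) C 2) ≤ r * (3 + 3 * ⟦ a ⟧) + c * (3 + 3 * ⟦ b ⟧)
charge-bound false false z≤n               z≤n               = ≤ᵇ⇒≤ _ _ tt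
charge-bound false false z≤n               (s≤s z≤n)         = ≤ᵇ⇒≤ _ _ tt
charge-bound false false (s≤s z≤n)         z≤n               = ≤ᵇ⇒≤ _ _ tt
charge-bound false false (s≤s z≤n)         (s≤s z≤n)         = ≤ᵇ⇒≤ _ _ tt
charge-bound false true  z≤n               z≤n               = ≤ᵇ⇒≤ _ _ tt
charge-bound false true  z≤n               (s≤s z≤n)         = ≤ᵇ⇒≤ _ _ tt
charge-bound false true  (s≤s z≤n)         z≤n               = ≤ᵇ⇒≤ _ _ tt
charge-bound false true  (s≤s z≤n)         (s≤s z≤n)         = ≤ᵇ⇒≤ _ _ tt
charge-bound false true  (s≤s (s≤s z≤n))   z≤n               = ≤ᵇ⇒≤ _ _ tt
charge-bound false true  (s≤s (s≤s z≤n))   (s≤s z≤n)         = ≤ᵇ⇒≤ _ _ tt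
charge-bound true  false z≤n               z≤n               = ≤ᵇ⇒≤ _ _ tt
charge-bound true  false z≤n               (s≤s z≤n)         = ≤ᵇ⇒≤ _ _ tt
charge-bound true  false z≤n               (s≤s (s≤s z≤n))   = ≤ᵇ⇒≤ _ _ tt
charge-bound true  false (s≤s z≤n)         z≤n               = ≤ᵇ⇒≤ _ _ tt
charge-bound true  false (s≤s z≤n)         (s≤s z≤n)         = ≤ᵇ⇒≤ _ _ tt
charge-bound true  false (s≤s z≤n)         (s≤s (s≤s z≤n))   = ≤ᵇ⇒≤ _ _ tt
charge-bound true  true  z≤n               z≤n               = ≤ᵇ⇒≤ _ _ tt
charge-bound true  true  z≤n               (s≤s z≤n)         = ≤ᵇ⇒≤ _ _ tt
charge-bound true  true  z≤n               (s≤s (s≤s z≤n))   = ≤ᵇ⇒≤ _ _ tt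
charge-bound true  true  (s≤s z≤n)         z≤n               = ≤ᵇ⇒≤ _ _ tt
charge-bound true  true  (s≤s z≤n)         (s≤s z≤n)         = ≤ᵇ⇒≤ _ _ tt
charge-bound true  true  (s≤s z≤n)         (s≤s (s≤s z≤n))   = ≤ᵇ⇒≤ _ _ tt
charge-bound true  true  (s≤s (s≤s z≤n))   z≤n               = ≤ᵇ⇒≤ _ _ tt
charge-bound true  true  (s≤s (s≤s z≤n))   (s≤s z≤n)         = ≤ᵇ⇒≤ _ _ tt
charge-bound true  true  (s≤s (s≤s z≤n))   (s≤s (s≤s z≤n))   = ≤ᵇ⇒≤ _ _ tt

∑-ascends-charge : ∀ n (π : Numbering (n * n)) →
  ∑[ u < n * n ] ∑[ x < n * n ] (⟦ ascends (Grid n) π u x ⟧ * gridWeight n charge u x)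
    ≡ (∑[ k < n ] pathDegree k) * (∑[ k < n ] charge k)
∑-ascends-charge n π = *-cancelˡ-≡ _ _ 2
  (trans (∑-ascends (Grid n) π (gridWeight n charge) (gridWeight-sym n charge))
         (∑-gridEdges n (gridWeight-lineWeighted n charge)))

charged-upDegree : ∀ n (π : Numbering (n * n)) (u : Fin (n * n)) →
  4 * (upDegree (Grid n) π u C 2) ≤ ∑[ x < n * n ] (⟦ ascends (Grid n) π u x ⟧ * gridWeight n charge u x)
charged-upDegree n π = ∀-combine n λ i j →
  subst₂ (λ d s → 4 * (d C 2) ≤ s) (sym (upDegree-combine n π i j))
         (sym (∑-ascends-combine n π i j (gridWeight-lineWeighted n charge)))
         (charge-bound (interior i) (interior j) (≤-trans (rowUp≤pathDegree n π i j) (pathDegree≤ j))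
                                                 (≤-trans (colUp≤pathDegree n π i j) (pathDegree≤ i)))

4*validity≤ : ∀ n (π : Numbering (n * n)) → 4 * validity (Grid n) π ≤ (∑[ k < n ] pathDegree k) * (∑[ k < n ] charge k)
4*validity≤ n π = begin
  4 * validity (Grid n) π                                               ≡⟨ *-distribˡ-validity (Grid n) π 4 ⟩
  ∑[ u < n * n ] (4 * (upDegree (Grid n) π u C 2))                      ≤⟨ ∑-mono-≤ (charged-upDegree n π) ⟩
  ∑[ u < n * n ] ∑[ x < n * n ] (⟦ ascends (Grid n) π u x ⟧ * gridWeight n charge u x) ≡⟨ ∑-ascends-charge n π ⟩
  (∑[ k < n ] pathDegree k) * (∑[ k < n ] charge k) ∎
  where open ≤-Reasoning

grid-charge-total : ∀ n → (∑[ k < n ] pathDegree k) * (∑[ k < n ] charge k) ≡ 4 * (3 * (n ∸ 1) ^ 2)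
grid-charge-total n = trans (cong₂ _*_ (∑-pathDegree n) (∑-charge n)) (identity n)
  where
  identity : ∀ n → ((n ∸ 1) + (n ∸ 1)) * (3 * n + 3 * (n ∸ 2)) ≡ 4 * (3 * (n ∸ 1) ^ 2)
  identity zero          = refl
  identity (suc zero)    = refl
  identity (suc (suc m)) = ring-identity m
    where
    ring-identity : ∀ m → (suc m + suc m) * (3 * suc (suc m) + 3 * m) ≡ 4 * (3 * (suc m * (suc m * 1)))
    ring-identity = solve-∀

validity-upper : ∀ n (π : Numbering (n * n)) → validity (Grid n) π ≤ 3 * (n ∸ 1) ^ 2
validity-upper n π = *-cancelˡ-≤ 4 (subst (4 * validity (Grid n) π ≤_) (grid-charge-total n) (4*validity≤ n π))

-- The checkerboard numbering
odd : ℕ → Bool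
odd zero    = false
odd (suc n) = not (odd n)

odd-+ : ∀ m n → odd (m + n) ≡ odd m xor odd n
odd-+ zero    n = refl
odd-+ (suc m) n = trans (cong not (odd-+ m n)) (not-distribˡ-xor (odd m) (odd n))

odd-* : ∀ m n → odd (m * n) ≡ odd m ∧ odd n
odd-* zero    n = refl
odd-* (suc m) n = trans (odd-+ n (m * n)) (trans (cong (odd n xor_) (odd-* m n)) (absorb (odd m) (odd n)))
  where
  absorb : ∀ a b → b xor (a ∧ b) ≡ not a ∧ b
  absorb false b     = xor-identityʳ b
  absorb true  false = refl
  absorb true  true  = refl

odd-double : ∀ m → odd (m + m) ≡ false
odd-double m = trans (odd-+ m m) (xor-same (odd m))

odd+⌊/2⌋+⌊/2⌋ : ∀ v → ⟦ odd v ⟧ + (⌊ v /2⌋ + ⌊ v /2⌋) ≡ v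
odd+⌊/2⌋+⌊/2⌋ zero          = refl
odd+⌊/2⌋+⌊/2⌋ (suc zero)    = refl
odd+⌊/2⌋+⌊/2⌋ (suc (suc v)) rewrite not-involutive (odd v) | +-suc ⌊ v /2⌋ ⌊ v /2⌋
  | +-suc ⟦ odd v ⟧ (suc (⌊ v /2⌋ + ⌊ v /2⌋)) | +-suc ⟦ odd v ⟧ (⌊ v /2⌋ + ⌊ v /2⌋) =
  cong (2 +_) (odd+⌊/2⌋+⌊/2⌋ v)

odd⇒≡1+2⌊/2⌋ : ∀ {v} → odd v ≡ true → suc (⌊ v /2⌋ + ⌊ v /2⌋) ≡ v
odd⇒≡1+2⌊/2⌋ {v} e = subst (λ b → ⟦ b ⟧ + (⌊ v /2⌋ + ⌊ v /2⌋) ≡ v) e (odd+⌊/2⌋+⌊/2⌋ v)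

even⇒≡2⌊/2⌋ : ∀ {v} → odd v ≡ false → ⌊ v /2⌋ + ⌊ v /2⌋ ≡ v
even⇒≡2⌊/2⌋ {v} e = subst (λ b → ⟦ b ⟧ + (⌊ v /2⌋ + ⌊ v /2⌋) ≡ v) e (odd+⌊/2⌋+⌊/2⌋ v)

module _ {N : ℕ} (f g : ℕ → ℕ) (f< : ∀ {v} → v < N → f v < N) (g< : ∀ {m} → m < N → g m < N)
         (g∘f : ∀ {v} → v < N → g (f v) ≡ v) (f∘g : ∀ {m} → m < N → f (g m) ≡ m) where

  private
    f′ g′ : Fin N → Fin N
    f′ v = fromℕ< (f< (toℕ<n v))
    g′ m = fromℕ< (g< (toℕ<n m))

  permutationFromℕ : Numbering N
  permutationFromℕ = permutation f′ g′
    (λ m → toℕ-injective (trans (toℕ-fromℕ< _) (trans (cong f (toℕ-fromℕ< _)) (f∘g (toℕ<n m)))))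
    (λ v → toℕ-injective (trans (toℕ-fromℕ< _) (trans (cong g (toℕ-fromℕ< _)) (g∘f (toℕ<n v)))))

  toℕ-permutationFromℕ : ∀ v → toℕ (permutationFromℕ ⟨$⟩ʳ v) ≡ f (toℕ v)
  toℕ-permutationFromℕ v = toℕ-fromℕ< _

module Checkerboard (N : ℕ) (N-odd : odd N ≡ true) where

  private
    h : ℕ
    h = ⌊ N /2⌋
    N≡1+h+h : suc (h + h) ≡ N
    N≡1+h+h = odd⇒≡1+2⌊/2⌋ N-odd

  σ σ⁻¹ : ℕ → ℕ
  σ v = if odd v then ⌊ v /2⌋ else h + ⌊ v /2⌋
  σ⁻¹ m = if m <ᵇ h then suc (m + m) else (m ∸ h) + (m ∸ h)

  private
    <N⇒≤h+h : ∀ {v} → v < N → v ≤ h + h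
    <N⇒≤h+h v<N = ≤-pred (subst (_ <_) (sym N≡1+h+h) v<N)

    odd⇒⌊/2⌋<h : ∀ {v} → v < N → odd v ≡ true → ⌊ v /2⌋ < h
    odd⇒⌊/2⌋<h v<N e = m+m<n+n⇒m<n (subst (_≤ _) (sym (odd⇒≡1+2⌊/2⌋ e)) (<N⇒≤h+h v<N))

    even⇒⌊/2⌋≤h : ∀ {v} → v < N → odd v ≡ false → ⌊ v /2⌋ ≤ h
    even⇒⌊/2⌋≤h v<N e = m+m≤n+n⇒m≤n (subst (_≤ _) (sym (even⇒≡2⌊/2⌋ e)) (<N⇒≤h+h v<N))

    ≤h+h⇒<N : ∀ {v} → v ≤ h + h → v < N
    ≤h+h⇒<N v≤ = subst (_ <_) N≡1+h+h (s≤s v≤)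

  σ< : ∀ {v} → v < N → σ v < N
  σ< {v} v<N with odd v in e
  ... | true  = ≤h+h⇒<N (≤-trans (<⇒≤ (odd⇒⌊/2⌋<h v<N e)) (m≤m+n h h))
  ... | false = ≤h+h⇒<N (+-monoʳ-≤ h (even⇒⌊/2⌋≤h v<N e))

  σ⁻¹< : ∀ {m} → m < N → σ⁻¹ m < N
  σ⁻¹< {m} m<N with m <ᵇ h in e
  ... | true  = subst (_ <_) N≡1+h+h (s≤s (+-mono-< m<h m<h))
    where m<h = <ᵇ⇒< m h (subst T (sym e) tt)
  ... | false = ≤h+h⇒<N (+-mono-≤ m∸h≤h m∸h≤h)
    where m∸h≤h = subst (m ∸ h ≤_) (m+n∸m≡n h h) (∸-monoˡ-≤ h (<N⇒≤h+h m<N))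

  σ⁻¹∘σ : ∀ {v} → v < N → σ⁻¹ (σ v) ≡ v
  σ⁻¹∘σ {v} v<N with odd v in e
  ... | true  rewrite <⇒<ᵇ≡true (odd⇒⌊/2⌋<h v<N e) = odd⇒≡1+2⌊/2⌋ e
  ... | false rewrite ≤⇒≮ᵇ (m≤m+n h ⌊ v /2⌋) | m+n∸m≡n h ⌊ v /2⌋ = even⇒≡2⌊/2⌋ e

  σ∘σ⁻¹ : ∀ {m} → m < N → σ (σ⁻¹ m) ≡ m
  σ∘σ⁻¹ {m} m<N with m <ᵇ h in e
  ... | true  rewrite odd-double m = sym (n≡⌈n+n/2⌉ m)
  ... | false rewrite odd-double (m ∸ h) = trans (cong (h +_) (sym (n≡⌊n+n/2⌋ (m ∸ h)))) (m+[n∸m]≡n h≤m)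
    where
    h≤m : h ≤ m
    h≤m = ≮⇒≥ (λ m<h → subst T e (<⇒<ᵇ m<h))

  numbering : Numbering N
  numbering = permutationFromℕ σ σ⁻¹ σ< σ⁻¹< σ⁻¹∘σ σ∘σ⁻¹

  numbering-across : ∀ u x → odd (toℕ u) ≡ not (odd (toℕ x)) →
    (toℕ (numbering ⟨$⟩ʳ u) <ᵇ toℕ (numbering ⟨$⟩ʳ x)) ≡ odd (toℕ u)
  numbering-across u x parity
    rewrite toℕ-permutationFromℕ σ σ⁻¹ σ< σ⁻¹< σ⁻¹∘σ σ∘σ⁻¹ u | toℕ-permutationFromℕ σ σ⁻¹ σ< σ⁻¹< σ⁻¹∘σ σ∘σ⁻¹ x
    with odd (toℕ u) in eu | odd (toℕ x) in ex
  ... | true  | false = <⇒<ᵇ≡true (<-≤-trans (odd⇒⌊/2⌋<h (toℕ<n u) eu) (m≤m+n h _))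
  ... | false | true  = ≤⇒≮ᵇ (≤-trans (<⇒≤ (odd⇒⌊/2⌋<h (toℕ<n x) ex)) (m≤m+n h _))
  ... | true  | true  with () ← parity
  ... | false | false with () ← parity

odd-square : ∀ {n} → odd n ≡ true → odd (n * n) ≡ true
odd-square {n} n-odd = trans (odd-* n n) (cong₂ _∧_ n-odd n-odd)

checkerboard : ∀ n → odd n ≡ true → Numbering (n * n)
checkerboard n n-odd = Checkerboard.numbering (n * n) (odd-square {n} n-odd)

alternating-pathAdj : ∀ (F : ℕ → ℕ) → (∀ y → odd (F (suc y)) ≡ not (odd (F y))) →
  ∀ a a′ → (∣ a - a′ ∣ ≡ᵇ 1) ≡ true → odd (F a) ≡ not (odd (F a′))
alternating-pathAdj F alt zero          (suc zero) _ = sym (trans (cong not (alt 0)) (not-involutive _))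
alternating-pathAdj F alt (suc zero)    zero       _ = alt 0
alternating-pathAdj F alt (suc a)       (suc a′)   e = alternating-pathAdj (F ∘ suc) (alt ∘ suc) a a′ e
alternating-pathAdj F alt zero          zero          ()
alternating-pathAdj F alt zero          (suc (suc a′)) ()
alternating-pathAdj F alt (suc (suc a)) zero          ()

-- A non-interior index is 0 or n ∸ 1, and both are even.
boundary-even : ∀ {n} → odd n ≡ true → (k : Fin n) → interior k ≡ false → odd (toℕ k) ≡ false
boundary-even {n} n-odd k = go (toℕ k) (toℕ<n k)
  where
  go : ∀ a → a < n → ((0 <ᵇ a) ∧ (suc a <ᵇ n)) ≡ false → odd a ≡ false
  go zero    _   _ = refl
  go (suc a) a<n e = trans (sym (not-involutive (odd (suc a)))) (cong not (trans (cong odd 2+a≡n) n-odd))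
    where
    2+a≡n : suc (suc a) ≡ n
    2+a≡n = ≤-antisym a<n (≮⇒≥ (λ 2+a<n → false≢true (trans (sym e) (<⇒<ᵇ≡true 2+a<n))))
      where
      false≢true : false ≢ true
      false≢true ()

charge-tight : ∀ a b → (a ∨ b) ≡ true →
  suc ⟦ b ⟧ * (3 + 3 * ⟦ a ⟧) + suc ⟦ a ⟧ * (3 + 3 * ⟦ b ⟧) ≡ 4 * ((suc ⟦ b ⟧ + suc ⟦ a ⟧) C 2)
charge-tight false true  _ = refl
charge-tight true  false _ = refl
charge-tight true  true  _ = refl

module _ (n : ℕ) (n-odd : odd n ≡ true) where

  open Checkerboard (n * n) (odd-square {n} n-odd)

  module _ (i j : Fin n) where

    private
      u : Fin (n * n)
      u = combine i j
      p : Bool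
      p = odd (toℕ u)
      toℕ-u : toℕ u ≡ n * toℕ i + toℕ j
      toℕ-u = toℕ-combine i j

    row-flip : ∀ j′ → pathAdj j j′ ≡ true → p ≡ not (odd (toℕ (combine i j′)))
    row-flip j′ e rewrite toℕ-u | toℕ-combine i j′ =
      alternating-pathAdj (n * toℕ i +_) (λ y → cong odd (+-suc (n * toℕ i) y)) (toℕ j) (toℕ j′) e

    column-flip : ∀ i′ → pathAdj i i′ ≡ true → p ≡ not (odd (toℕ (combine i′ j)))
    column-flip i′ e rewrite toℕ-u | toℕ-combine i′ j =
      alternating-pathAdj (λ a → n * a + toℕ j) step (toℕ i) (toℕ i′) e
      where
      step : ∀ y → odd (n * suc y + toℕ j) ≡ not (odd (n * y + toℕ j))
      step y rewrite *-suc n y | +-assoc n (n * y) (toℕ j) | odd-+ n (n * y + toℕ j) | n-odd = refl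

    rowUp-checkerboard : rowUp n numbering i j ≡ pathDegree j * ⟦ p ⟧
    rowUp-checkerboard =
      trans (∑-⟦⟧*-cong (pathAdj j) (λ j′ e → cong ⟦_⟧ (numbering-across u (combine i j′) (row-flip j′ e))))
            (sym (*-distribʳ-sum ⟦ p ⟧ (λ j′ → ⟦ pathAdj j j′ ⟧)))

    colUp-checkerboard : colUp n numbering i j ≡ pathDegree i * ⟦ p ⟧
    colUp-checkerboard =
      trans (∑-⟦⟧*-cong (pathAdj i) (λ i′ e → cong ⟦_⟧ (numbering-across u (combine i′ j) (column-flip i′ e))))
            (sym (*-distribʳ-sum ⟦ p ⟧ (λ i′ → ⟦ pathAdj i i′ ⟧)))

    corner-even : interior i ≡ false → interior j ≡ false → p ≡ false
    corner-even ei ej rewrite toℕ-u | odd-+ (n * toℕ i) (toℕ j) | odd-* n (toℕ i)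
                            | n-odd | boundary-even n-odd i ei | boundary-even n-odd j ej = refl

    odd-vertex-interior : p ≡ true → (interior i ∨ interior j) ≡ true
    odd-vertex-interior e with interior i in ei | interior j in ej
    ... | true  | _    = refl
    ... | false | true = refl
    ... | false | false with () ← trans (sym e) (corner-even ei ej)

    charged-checkerboard : 2 ≤ n →
      rowUp n numbering i j * charge i + colUp n numbering i j * charge j
        ≤ 4 * ((rowUp n numbering i j + colUp n numbering i j) C 2)
    charged-checkerboard 2≤n rewrite rowUp-checkerboard | colUp-checkerboard with p in e
    ... | false rewrite *-zeroʳ (pathDegree j) | *-zeroʳ (pathDegree i) = z≤n
    ... | true  rewrite *-identityʳ (pathDegree j) | *-identityʳ (pathDegree i)
                      | pathDegree≡1+interior j 2≤n | pathDegree≡1+interior i 2≤n =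
      ≤-reflexive (charge-tight (interior i) (interior j) (odd-vertex-interior e))

  4*validity-checkerboard≥ : 2 ≤ n →
    (∑[ k < n ] pathDegree k) * (∑[ k < n ] charge k) ≤ 4 * validity (Grid n) numbering
  4*validity-checkerboard≥ 2≤n = begin
    (∑[ k < n ] pathDegree k) * (∑[ k < n ] charge k)                ≡⟨ ∑-ascends-charge n numbering ⟨
    ∑[ u < n * n ] ∑[ x < n * n ] (⟦ ascends (Grid n) numbering u x ⟧ * gridWeight n charge u x)
      ≤⟨ ∑-mono-≤ (∀-combine n vertex) ⟩
    ∑[ u < n * n ] (4 * (upDegree (Grid n) numbering u C 2))  ≡⟨ *-distribˡ-validity (Grid n) numbering 4 ⟨
    4 * validity (Grid n) numbering ∎
    where
    open ≤-Reasoning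
    vertex : ∀ i j → ∑[ x < n * n ] (⟦ ascends (Grid n) numbering (combine i j) x ⟧ * gridWeight n charge (combine i j) x)
                       ≤ 4 * (upDegree (Grid n) numbering (combine i j) C 2)
    vertex i j = subst₂ (λ s d → s ≤ 4 * (d C 2))
      (sym (∑-ascends-combine n numbering i j (gridWeight-lineWeighted n charge)))
      (sym (upDegree-combine n numbering i j))
      (charged-checkerboard i j 2≤n)

validity-checkerboard : ∀ n (n-odd : odd n ≡ true) → 3 * (n ∸ 1) ^ 2 ≤ validity (Grid n) (checkerboard n n-odd)
validity-checkerboard (suc zero)    n-odd = z≤n
validity-checkerboard (suc (suc m)) n-odd =
  *-cancelˡ-≤ 4 (subst (_≤ 4 * validity (Grid n) (checkerboard n n-odd)) (grid-charge-total n)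
                       (4*validity-checkerboard≥ n n-odd (s≤s (s≤s z≤n))))
  where
  n : ℕ
  n = suc (suc m)

lemma8 : ∀ (n : ℕ) → (∃ λ k → n ≡ suc (2 * k)) →
    IsPhiMin (Grid n) ((n ∸ 1) ^ 2) × IsPhiMax (Grid n) (3 * (n ∸ 1) ^ 2)
lemma8 n (k , refl) =
  (validity-lower n , (ι , ≤-antisym (validity-id≤ n) (validity-lower n ι))) ,
  (validity-upper n , (π , ≤-antisym (validity-upper n π) (validity-checkerboard n n-odd)))
  where
  ι : Numbering (n * n)
  ι = Data.Fin.Permutation.id
  n-odd : odd n ≡ true
  n-odd = cong not (trans (cong (λ m → odd (k + m)) (+-identityʳ k)) (odd-double k))
  π : Numbering (n * n)
  π = checkerboard n n-odd
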